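{- For every integer $m\ge 1$ there is a constant $C>0$ depending only on $m$ such that for all integers $N\ge 2$, \[ r_m(2m+1,N)\ \ge\ N\exp\!\big(-C\sqrt{\log N}\big). \]
   Context: For integers $m\ge 1$, $k\ge 2$, $N\ge 1$, $r_m(k,N)$ denotes the maximal cardinality of a subset $A\subseteq\{0,1,\ldots,N-1\}$ such that there do not exist integers $x,a_1,\ldots,a_m$, with at least one $a_i\neq 0$, for which $x+\sum_{i=1}^m a_i j^i\in A$ for every $j=0,1,\ldots,k-1$. (The $a_i$ need not belong to $A$, and the values $x+\sum_i a_ij^i$ need not be distinct.) -}

module Defs where

open import Data.Nat as ℕ using (ℕ; zero; suc)
open import Data.Integer as ℤ using (ℤ; +_; 0ℤ)
open import Data.Fin using (Fin; zero; suc; toℕ)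
open import Data.Fin.Subset using (Subset; _∈_)
open import Data.Product using (Σ; ∃; _×_; _,_)
open import Relation.Binary.PropositionalEquality using (_≡_; _≢_)
open import Relation.Nullary using (¬_)

-- polyPart m a j = Σ_{i=1}^{m} a_i j^i, where a : Fin m → ℤ and the
-- coefficient a_i is stored at index (i - 1), i.e. a ι is the coefficient
-- of j ^ (toℕ ι + 1).
polyPart : (m : ℕ) → (Fin m → ℤ) → ℤ → ℤ
polyPart zero    a j = 0ℤ
polyPart (suc m) a j = a zero ℤ.* (j ℤ.^ 1) ℤ.+ polyPart m (λ ι → a (suc ι)) j ℤ.* j

-- Integer v lies in A ⊆ {0,…,N-1} (A encoded as a Subset of Fin N,
-- element ι ∈ Fin N representing the integer toℕ ι).
_∈ℤ_ : ℤ → {N : ℕ} → Subset N → Set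
_∈ℤ_ v {N} A = Σ (Fin N) λ ι → (+ toℕ ι ≡ v) × (ι ∈ A)

HasConfig : (m k : ℕ) {N : ℕ} → Subset N → Set
HasConfig m k A =
  Σ ℤ λ x → Σ (Fin m → ℤ) λ a →
    (Σ (Fin m) λ i → a i ≢ 0ℤ) ×
    ((j : Fin k) → (x ℤ.+ polyPart m a (+ toℕ j)) ∈ℤ A)

-- A is admissible in the definition of r_m(k, N).
ConfigFree : (m k : ℕ) {N : ℕ} → Subset N → Set
ConfigFree m k A = ¬ HasConfig m k A

{-# OPTIONS --safe #-}
module Submission where

-- A Behrend-type construction. Fix a base D and a digit bound B with B · 2^(m+1) < D, and take
-- the numbers below D^n whose n base-D digits are all at most B and whose digit vector has a
-- fixed squared norm R. Along a configuration x + Σ aᵢ jⁱ, j = 0, …, 2m, the (m+1)-st finite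
-- differences vanish; as the digits are small these differences cause no carries, so every
-- digit is itself a polynomial of degree ≤ m in j. The sum of their squares has degree ≤ 2m and
-- is constant at 2m + 1 points, so its top coefficient, a positive multiple of the sum of the
-- squares of the digits' top coefficients, vanishes. Descending in the degree, every digit, hence
-- the configuration, is constant, and all aᵢ = 0. Since (B + 1)^n numbers have small digits but
-- there are at most n B² + 1 norms, some sphere is large; with 2^(ts) ≤ N < 2^((t+1)s), D = 2^t,
-- n = s and B + 1 = 2^(t-m-1), its density is at least 2^(-(m+5)s).

open import Data.Nat.Base as ℕ using (ℕ; NonZero)

module Difference where

  open import Data.Nat.Base as ℕ using (zero; suc; z≤n; s≤s; _^_)
  import Data.Nat.Properties as ℕ
  open import Data.Nat.Tactic.RingSolver as ℕ using ()
  open import Data.Integer.Base using (ℤ; 0ℤ; _+_; _-_; _*_; ∣_∣)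
  import Data.Integer.Properties as ℤ
  open import Data.Integer.Tactic.RingSolver using (solve-∀)
  open import Function.Base using (_∘_)
  open import Relation.Binary.PropositionalEquality

  Δ : (ℕ → ℤ) → ℕ → ℤ
  Δ g j = g (suc j) - g j

  Δ^ : ℕ → (ℕ → ℤ) → ℕ → ℤ
  Δ^ zero    g = g
  Δ^ (suc e) g = Δ^ e (Δ g)

  Δ^-cong : ∀ e {g h} → g ≗ h → Δ^ e g ≗ Δ^ e h
  Δ^-cong zero    g≗h = g≗h
  Δ^-cong (suc e) g≗h = Δ^-cong e (λ j → cong₂ _-_ (g≗h (suc j)) (g≗h j))

  Δ^-+ : ∀ e g h → Δ^ e (λ j → g j + h j) ≗ λ j → Δ^ e g j + Δ^ e h j
  Δ^-+ zero    g h j = refl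
  Δ^-+ (suc e) g h j = trans (Δ^-cong e (λ i → swap (g (suc i)) (h (suc i)) (g i) (h i)) j) (Δ^-+ e (Δ g) (Δ h) j)
    where
    swap : ∀ a b c d → a + b - (c + d) ≡ (a - c) + (b - d)
    swap = solve-∀

  Δ^-*ˡ : ∀ e c g → Δ^ e (λ j → c * g j) ≗ λ j → c * Δ^ e g j
  Δ^-*ˡ zero    c g j = refl
  Δ^-*ˡ (suc e) c g j =
    trans (Δ^-cong e (λ i → factor c (g (suc i)) (g i)) j) (Δ^-*ˡ e c (Δ g) j)
    where
    factor : ∀ c a b → c * a - c * b ≡ c * (a - b)
    factor = solve-∀

  Δ^-shift : ∀ e g → Δ^ e (g ∘ suc) ≗ Δ^ e g ∘ suc
  Δ^-shift zero    g j = refl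
  Δ^-shift (suc e) g j = Δ^-shift e (Δ g) j

  Δ^-Δ : ∀ e g → Δ^ e (Δ g) ≗ Δ (Δ^ e g)
  Δ^-Δ zero    g j = refl
  Δ^-Δ (suc e) g j = Δ^-Δ e (Δ g) j

  Δ^-0 : ∀ e → Δ^ e (λ _ → 0ℤ) ≗ λ _ → 0ℤ
  Δ^-0 zero    j = refl
  Δ^-0 (suc e) j = Δ^-0 e j

  Δ^-local : ∀ e g h j → (∀ i → i ℕ.≤ e → g (i ℕ.+ j) ≡ h (i ℕ.+ j)) → Δ^ e g j ≡ Δ^ e h j
  Δ^-local zero    g h j agree = agree 0 z≤n
  Δ^-local (suc e) g h j agree =
    Δ^-local e (Δ g) (Δ h) j (λ i i≤e → cong₂ _-_ (agree (suc i) (s≤s i≤e)) (agree i (ℕ.m≤n⇒m≤1+n i≤e)))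

  window-≤ : ∀ {i e j L} → i ℕ.≤ e → j ℕ.+ e ℕ.≤ L → i ℕ.+ j ℕ.≤ L
  window-≤ {i} {e} {j} i≤e j+e≤L = ℕ.≤-trans (ℕ.+-monoˡ-≤ j i≤e) (ℕ.≤-trans (ℕ.≤-reflexive (ℕ.+-comm e j)) j+e≤L)

  ∣Δ^∣≤ : ∀ e g j B → (∀ i → i ℕ.≤ e → ∣ g (i ℕ.+ j) ∣ ℕ.≤ B) → ∣ Δ^ e g j ∣ ℕ.≤ B ℕ.* 2 ^ e
  ∣Δ^∣≤ zero    g j B ∣g∣≤B = ℕ.≤-trans (∣g∣≤B 0 z≤n) (ℕ.≤-reflexive (sym (ℕ.*-identityʳ B)))
  ∣Δ^∣≤ (suc e) g j B ∣g∣≤B = ℕ.≤-trans (∣Δ^∣≤ e (Δ g) j (B ℕ.+ B) ∣Δg∣≤2B) (ℕ.≤-reflexive (double B (2 ^ e)))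
    where
    ∣Δg∣≤2B : ∀ i → i ℕ.≤ e → ∣ Δ g (i ℕ.+ j) ∣ ℕ.≤ B ℕ.+ B
    ∣Δg∣≤2B i i≤e = ℕ.≤-trans (ℤ.∣i-j∣≤∣i∣+∣j∣ (g (suc i ℕ.+ j)) (g (i ℕ.+ j)))
                      (ℕ.+-mono-≤ (∣g∣≤B (suc i) (s≤s i≤e)) (∣g∣≤B i (ℕ.m≤n⇒m≤1+n i≤e)))
    double : ∀ b p → (b ℕ.+ b) ℕ.* p ≡ b ℕ.* (2 ℕ.* p)
    double = ℕ.solve-∀

module Sum where

  open import Data.Nat.Base as ℕ using (zero; suc)
  import Data.Nat.Properties as ℕ
  open import Data.Integer.Base using (+_; _+_)
  import Data.Integer.Properties as ℤ
  open import Data.Fin.Base using (Fin; zero; suc)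
  open import Data.Product.Base using (∃; _,_)
  open import Data.Sum.Base using (inj₁; inj₂)
  open import Function.Base using (_∘_)
  open import Relation.Binary.PropositionalEquality
  import Algebra.Properties.CommutativeMonoid.Sum as CommutativeMonoidSum

  module ℕ∑ = CommutativeMonoidSum ℕ.+-0-commutativeMonoid
  module ℤ∑ = CommutativeMonoidSum ℤ.+-0-commutativeMonoid

  ∑-+ : ∀ n (f : Fin n → ℕ) → ℤ∑.sum (λ k → + f k) ≡ + ℕ∑.sum f
  ∑-+ zero    f = refl
  ∑-+ (suc n) f = trans (cong (_+_ (+ f zero)) (∑-+ n (f ∘ suc))) (sym (ℤ.pos-+ (f zero) _))

  ∑≡0⇒≡0 : ∀ n (f : Fin n → ℕ) → ℕ∑.sum f ≡ 0 → ∀ k → f k ≡ 0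
  ∑≡0⇒≡0 (suc n) f ∑f≡0 zero    = ℕ.m+n≡0⇒m≡0 (f zero) ∑f≡0
  ∑≡0⇒≡0 (suc n) f ∑f≡0 (suc k) = ∑≡0⇒≡0 n (f ∘ suc) (ℕ.m+n≡0⇒n≡0 (f zero) ∑f≡0) k

  pigeonhole : ∀ K (X : Fin (suc K) → ℕ) → ∃ λ R → ℕ∑.sum X ℕ.≤ suc K ℕ.* X R
  pigeonhole zero    X = zero , ℕ.≤-refl
  pigeonhole (suc K) X with pigeonhole K (X ∘ suc)
  ... | R , ∑≤ with ℕ.≤-total (X zero) (X (suc R))
  ...   | inj₁ X₀≤X[R+1] = suc R , ℕ.+-mono-≤ X₀≤X[R+1] ∑≤
  ...   | inj₂ X[R+1]≤X₀ = zero , ℕ.+-monoʳ-≤ (X zero) (ℕ.≤-trans ∑≤ (ℕ.*-monoʳ-≤ (suc K) X[R+1]≤X₀))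

module PolynomialSequence where

  open import Data.Nat.Base as ℕ using (zero; suc; z≤n; s≤s)
  import Data.Nat.Properties as ℕ
  open import Data.Integer.Base using (ℤ; +_; -[1+_]; 0ℤ; 1ℤ; _+_; _-_; _*_; ∣_∣)
  import Data.Integer.Properties as ℤ
  open import Data.Integer.Tactic.RingSolver using (solve-∀)
  open import Data.Fin.Base using (Fin; zero; suc)
  open import Data.Sum.Base using ([_,_]′)
  open import Function.Base using (_∘_; id)
  open import Relation.Binary.PropositionalEquality
  open Difference
  open Sum
  open ℤ∑ using (sum; sum-syntax)

  ConstΔ^ : ℕ → (ℕ → ℤ) → ℤ → Set
  ConstΔ^ e g c = ∀ j → Δ^ e g j ≡ c

  Degree≤ : ℕ → (ℕ → ℤ) → Set
  Degree≤ e g = ConstΔ^ (suc e) g 0ℤ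

  ConstΔ^-cong : ∀ e {g h c} → g ≗ h → ConstΔ^ e g c → ConstΔ^ e h c
  ConstΔ^-cong e g≗h Δ^g≡c j = trans (sym (Δ^-cong e g≗h j)) (Δ^g≡c j)

  ConstΔ^-+ : ∀ e g h {c d} → ConstΔ^ e g c → ConstΔ^ e h d → ConstΔ^ e (λ j → g j + h j) (c + d)
  ConstΔ^-+ e g h Δ^g≡c Δ^h≡d j = trans (Δ^-+ e g h j) (cong₂ _+_ (Δ^g≡c j) (Δ^h≡d j))

  ConstΔ^-*ˡ : ∀ e a g {c} → ConstΔ^ e g c → ConstΔ^ e (λ j → a * g j) (a * c)
  ConstΔ^-*ˡ e a g Δ^g≡c j = trans (Δ^-*ˡ e a g j) (cong (a *_) (Δ^g≡c j))

  ConstΔ^-shift : ∀ e g {c} → ConstΔ^ e g c → ConstΔ^ e (g ∘ suc) c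
  ConstΔ^-shift e g Δ^g≡c j = trans (Δ^-shift e g j) (Δ^g≡c (suc j))

  Degree≤⇒ConstΔ^ : ∀ e g → Degree≤ e g → ConstΔ^ e g (Δ^ e g 0)
  Degree≤⇒ConstΔ^ e g deg zero    = refl
  Degree≤⇒ConstΔ^ e g deg (suc j) =
    trans (ℤ.i-j≡0⇒i≡j _ _ (trans (sym (Δ^-Δ e g j)) (deg j))) (Degree≤⇒ConstΔ^ e g deg j)

  Degree≤0⇒const : ∀ g → Degree≤ 0 g → ∀ j → g j ≡ g 0
  Degree≤0⇒const = Degree≤⇒ConstΔ^ 0

  Degree≤-cong : ∀ e {g h} → g ≗ h → Degree≤ e g → Degree≤ e h
  Degree≤-cong e = ConstΔ^-cong (suc e)

  Degree≤-const : ∀ e c → Degree≤ e (λ _ → c)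
  Degree≤-const e c j = trans (Δ^-cong e (λ _ → ℤ.+-inverseʳ c) j) (Δ^-0 e j)

  Degree≤-+ : ∀ e g h → Degree≤ e g → Degree≤ e h → Degree≤ e (λ j → g j + h j)
  Degree≤-+ e g h = ConstΔ^-+ (suc e) g h

  Degree≤-shift : ∀ e g → Degree≤ e g → Degree≤ e (g ∘ suc)
  Degree≤-shift e g = ConstΔ^-shift (suc e) g

  Degree≤-*id : ∀ e g → Degree≤ e g → Degree≤ (suc e) (λ j → g j * + j)
  Degree≤-*id e g deg = ConstΔ^-cong (suc e) (λ j → sym (product-rule (g (suc j)) (g j) (+ j))) (Δ-degree e deg)
    where
    product-rule : ∀ a b x → a * (1ℤ + x) - b * x ≡ (a - b) * x + a
    product-rule = solve-∀
    Δ-degree : ∀ e → Degree≤ e g → Degree≤ e (λ j → Δ g j * + j + g (suc j))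
    Δ-degree zero    deg = Degree≤-+ 0 (λ j → Δ g j * + j) (g ∘ suc)
      (Degree≤-cong 0 (λ j → sym (cong (_* + j) (deg j))) (Degree≤-const 0 0ℤ)) (Degree≤-shift 0 g deg)
    Δ-degree (suc e) deg = Degree≤-+ (suc e) (λ j → Δ g j * + j) (g ∘ suc)
      (Degree≤-*id e (Δ g) deg) (Degree≤-shift (suc e) g deg)

  Degree≤-roots⇒≡0 : ∀ e g → Degree≤ e g → (∀ j → j ℕ.≤ e → g j ≡ 0ℤ) → ∀ j → g j ≡ 0ℤ
  Degree≤-roots⇒≡0 zero    g deg g≡0 j = trans (Degree≤0⇒const g deg j) (g≡0 0 z≤n)
  Degree≤-roots⇒≡0 (suc e) g deg g≡0 j = trans (Degree≤0⇒const g Δg≡0 j) (g≡0 0 z≤n)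
    where
    Δg≡0 : ∀ j → Δ g j ≡ 0ℤ
    Δg≡0 = Degree≤-roots⇒≡0 e (Δ g) deg
             (λ j j≤e → cong₂ _-_ (g≡0 (suc j) (s≤s j≤e)) (g≡0 j (ℕ.m≤n⇒m≤1+n j≤e)))

  Degree≤-roots-suc⇒root-0 : ∀ e g → Degree≤ e g → (∀ j → g (suc j) ≡ 0ℤ) → g 0 ≡ 0ℤ
  Degree≤-roots-suc⇒root-0 zero    g deg g∘suc≡0 = trans (sym (Degree≤0⇒const g deg 1)) (g∘suc≡0 0)
  Degree≤-roots-suc⇒root-0 (suc e) g deg g∘suc≡0 = trans (sym (ℤ.i-j≡0⇒i≡j _ _ Δg0≡0)) (g∘suc≡0 0)
    where
    Δg0≡0 : Δ g 0 ≡ 0ℤ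
    Δg0≡0 = Degree≤-roots-suc⇒root-0 e (Δ g) deg (λ j → cong₂ _-_ (g∘suc≡0 (suc j)) (g∘suc≡0 j))

  -- binom e e' is the binomial coefficient (e + e') choose e.
  binom : ℕ → ℕ → ℕ
  binom zero    e'       = 1
  binom (suc e) zero     = 1
  binom (suc e) (suc e') = binom e (suc e') ℕ.+ binom (suc e) e'

  binom>0 : ∀ e e' → binom e e' ℕ.> 0
  binom>0 zero    e'       = s≤s z≤n
  binom>0 (suc e) zero     = s≤s z≤n
  binom>0 (suc e) (suc e') = ℕ.<-≤-trans (binom>0 e (suc e')) (ℕ.m≤m+n _ _)

  ConstΔ^-* : ∀ e e' g h {c c'} → ConstΔ^ e g c → ConstΔ^ e' h c' →
              ConstΔ^ (e ℕ.+ e') (λ j → g j * h j) (+ binom e e' * (c * c'))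
  ConstΔ^-* zero e' g h {c} {c'} g≡c Δ^h≡c' =
    subst (ConstΔ^ e' (λ j → g j * h j)) (sym (ℤ.*-identityˡ (c * c')))
      (ConstΔ^-cong e' (λ j → cong (_* h j) (sym (g≡c j))) (ConstΔ^-*ˡ e' c h Δ^h≡c'))
  ConstΔ^-* (suc e) zero g h {c} {c'} Δ^g≡c h≡c' =
    subst₂ (λ e'' d → ConstΔ^ e'' (λ j → g j * h j) d)
      (sym (ℕ.+-identityʳ (suc e))) (trans (ℤ.*-comm c' c) (sym (ℤ.*-identityˡ (c * c'))))
      (ConstΔ^-cong (suc e) (λ j → trans (ℤ.*-comm c' (g j)) (cong (g j *_) (sym (h≡c' j))))
         (ConstΔ^-*ˡ (suc e) c' g Δ^g≡c))
  ConstΔ^-* (suc e) (suc e') g h {c} {c'} Δ^g≡c Δ^h≡c' =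
    subst (ConstΔ^ (e ℕ.+ suc e') (Δ (λ j → g j * h j)))
      (sym (ℤ.*-distribʳ-+ (c * c') (+ binom e (suc e')) (+ binom (suc e) e')))
      (ConstΔ^-cong (e ℕ.+ suc e') (λ j → sym (leibniz (g (suc j)) (h (suc j)) (g j) (h j)))
         (ConstΔ^-+ (e ℕ.+ suc e') (λ j → Δ g j * h (suc j)) (λ j → g j * Δ h j) Δg·h∘suc g·Δh))
    where
    leibniz : ∀ a b c d → a * b - c * d ≡ (a - c) * b + c * (b - d)
    leibniz = solve-∀
    Δg·h∘suc : ConstΔ^ (e ℕ.+ suc e') (λ j → Δ g j * h (suc j)) (+ binom e (suc e') * (c * c'))
    Δg·h∘suc = ConstΔ^-* e (suc e') (Δ g) (h ∘ suc) Δ^g≡c (ConstΔ^-shift (suc e') h Δ^h≡c')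
    g·Δh : ConstΔ^ (e ℕ.+ suc e') (λ j → g j * Δ h j) (+ binom (suc e) e' * (c * c'))
    g·Δh = subst (λ e'' → ConstΔ^ e'' (λ j → g j * Δ h j) (+ binom (suc e) e' * (c * c'))) (sym (ℕ.+-suc e e'))
             (ConstΔ^-* (suc e) e' g (Δ h) Δ^g≡c Δ^h≡c')

  ConstΔ^-∑ : ∀ e n (w : Fin n → ℕ → ℤ) (c : Fin n → ℤ) → (∀ k → ConstΔ^ e (w k) (c k)) →
              ConstΔ^ e (λ j → ∑[ k < n ] w k j) (∑[ k < n ] c k)
  ConstΔ^-∑ e zero    w c Δ^w≡c = Δ^-0 e
  ConstΔ^-∑ e (suc n) w c Δ^w≡c =
    ConstΔ^-+ e (w zero) (λ j → ∑[ k < n ] w (suc k) j) (Δ^w≡c zero) (ConstΔ^-∑ e n (w ∘ suc) (c ∘ suc) (Δ^w≡c ∘ suc))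

  i*i≡+∣i∣*∣i∣ : ∀ i → i * i ≡ + (∣ i ∣ ℕ.* ∣ i ∣)
  i*i≡+∣i∣*∣i∣ (+ n)      = sym (ℤ.pos-* n n)
  i*i≡+∣i∣*∣i∣ -[1+ n ] = refl

  ∑-squares≡0⇒≡0 : ∀ n K .{{_ : ℕ.NonZero K}} (c : Fin n → ℤ) →
                   ∑[ k < n ] (+ K * (c k * c k)) ≡ 0ℤ → ∀ k → c k ≡ 0ℤ
  ∑-squares≡0⇒≡0 n K c ∑≡0 k =
    ℤ.∣i∣≡0⇒i≡0 ([ id , id ]′ (ℕ.m*n≡0⇒m≡0∨n≡0 ∣ c k ∣ (ℕ.m*n≡0⇒m≡0 _ K K∣c∣²≡0)))
    where
    K∣c∣² : Fin n → ℕ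
    K∣c∣² k = K ℕ.* (∣ c k ∣ ℕ.* ∣ c k ∣)
    ∑K∣c∣²≡0 : ℕ∑.sum K∣c∣² ≡ 0
    ∑K∣c∣²≡0 = ℤ.+-injective (begin
      + ℕ∑.sum K∣c∣²                   ≡⟨ ∑-+ n K∣c∣² ⟨
      ∑[ k < n ] (+ K∣c∣² k)           ≡⟨ ℤ∑.sum-cong-≗ (λ k → trans (ℤ.pos-* K _)
                                              (cong (+ K *_) (sym (i*i≡+∣i∣*∣i∣ (c k))))) ⟩
      ∑[ k < n ] (+ K * (c k * c k))   ≡⟨ ∑≡0 ⟩
      0ℤ                               ∎)
      where open ≡-Reasoning
    K∣c∣²≡0 : ∣ c k ∣ ℕ.* ∣ c k ∣ ℕ.* K ≡ 0
    K∣c∣²≡0 = trans (ℕ.*-comm _ K) (∑≡0⇒≡0 n K∣c∣² ∑K∣c∣²≡0 k)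

  constantSumOfSquares⇒constant : ∀ e n (w : Fin n → ℕ → ℤ) R → (∀ k → Degree≤ e (w k)) →
    (∀ j → j ℕ.≤ e ℕ.+ e → ∑[ k < n ] (w k j * w k j) ≡ R) → ∀ k → Degree≤ 0 (w k)
  constantSumOfSquares⇒constant zero    n w R deg ∑w²≡R = deg
  constantSumOfSquares⇒constant (suc e) n w R deg ∑w²≡R =
    constantSumOfSquares⇒constant e n w R deg′ (λ j j≤e+e → ∑w²≡R j (ℕ.≤-trans j≤e+e e+e≤))
    where
    e+e≤ : e ℕ.+ e ℕ.≤ suc e ℕ.+ suc e
    e+e≤ = ℕ.+-mono-≤ (ℕ.n≤1+n e) (ℕ.n≤1+n e)
    ∑w² : ℕ → ℤ
    ∑w² j = ∑[ k < n ] (w k j * w k j)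
    c : Fin n → ℤ
    c k = Δ^ (suc e) (w k) 0
    Δ^w≡c : ∀ k → ConstΔ^ (suc e) (w k) (c k)
    Δ^w≡c k = Degree≤⇒ConstΔ^ (suc e) (w k) (deg k)
    Δ^∑w²≡∑c² : ConstΔ^ (suc e ℕ.+ suc e) ∑w² (∑[ k < n ] (+ binom (suc e) (suc e) * (c k * c k)))
    Δ^∑w²≡∑c² = ConstΔ^-∑ (suc e ℕ.+ suc e) n (λ k j → w k j * w k j) _
                  (λ k → ConstΔ^-* (suc e) (suc e) (w k) (w k) (Δ^w≡c k) (Δ^w≡c k))
    Δ^∑w²≡0 : Δ^ (suc e ℕ.+ suc e) ∑w² 0 ≡ 0ℤ
    Δ^∑w²≡0 = trans (Δ^-local (suc e ℕ.+ suc e) ∑w² (λ _ → R) 0 (λ i i≤ → ∑w²≡R (i ℕ.+ 0) (window-≤ i≤ ℕ.≤-refl)))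
                    (Degree≤-const (e ℕ.+ suc e) R 0)
    c≡0 : ∀ k → c k ≡ 0ℤ
    c≡0 = ∑-squares≡0⇒≡0 n (binom (suc e) (suc e)) {{ℕ.>-nonZero (binom>0 (suc e) (suc e))}} c
            (trans (sym (Δ^∑w²≡∑c² 0)) Δ^∑w²≡0)
    deg′ : ∀ k → Degree≤ e (w k)
    deg′ k = subst (ConstΔ^ (suc e) (w k)) (c≡0 k) (Δ^w≡c k)

  Degree≤On : ℕ → ℕ → (ℕ → ℤ) → Set
  Degree≤On L e g = ∀ j → j ℕ.+ suc e ℕ.≤ L → Δ^ (suc e) g j ≡ 0ℤ

  Degree≤-agree⇒Degree≤On : ∀ L e g h → Degree≤ e g → (∀ j → j ℕ.≤ L → g j ≡ h j) → Degree≤On L e h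
  Degree≤-agree⇒Degree≤On L e g h deg g≡h j j+e<L =
    trans (Δ^-local (suc e) h g j (λ i i≤e → sym (g≡h (i ℕ.+ j) (window-≤ i≤e j+e<L)))) (deg j)

  partialSum : (ℕ → ℤ) → ℕ → ℤ
  partialSum h zero    = 0ℤ
  partialSum h (suc j) = partialSum h j + h j

  interpolate : ℕ → (ℕ → ℤ) → ℕ → ℤ
  interpolate zero    g j = g 0
  interpolate (suc e) g j = g 0 + partialSum (interpolate e (Δ g)) j

  interpolate-degree≤ : ∀ e g → Degree≤ e (interpolate e g)
  interpolate-degree≤ zero    g = Degree≤-const 0 (g 0)
  interpolate-degree≤ (suc e) g =
    ConstΔ^-cong (suc e) (λ j → sym (telescope (g 0) (partialSum (interpolate e (Δ g)) j) _))
      (interpolate-degree≤ e (Δ g))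
    where
    telescope : ∀ a s h → a + (s + h) - (a + s) ≡ h
    telescope = solve-∀

  interpolate-agrees : ∀ e g L → Degree≤On L e g → ∀ j → j ℕ.≤ L → interpolate e g j ≡ g j
  interpolate-agrees zero    g L       deg zero    j≤L       = refl
  interpolate-agrees zero    g L       deg (suc j) j<L       =
    trans (interpolate-agrees zero g L deg j (ℕ.<⇒≤ j<L))
          (sym (ℤ.i-j≡0⇒i≡j _ _ (deg j (ℕ.≤-trans (ℕ.≤-reflexive (ℕ.+-comm j 1)) j<L))))
  interpolate-agrees (suc e) g L       deg zero    j≤L       = ℤ.+-identityʳ (g 0)
  interpolate-agrees (suc e) g (suc L) deg (suc j) (s≤s j≤L) = begin
    g 0 + (partialSum I′ j + I′ j)   ≡⟨ ℤ.+-assoc (g 0) _ _ ⟨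
    interpolate (suc e) g j + I′ j   ≡⟨ cong₂ _+_ (interpolate-agrees (suc e) g (suc L) deg j (ℕ.m≤n⇒m≤1+n j≤L))
                                                  (interpolate-agrees e (Δ g) L degΔ j j≤L) ⟩
    g j + Δ g j                      ≡⟨ step (g j) (g (suc j)) ⟩
    g (suc j)                        ∎
    where
    open ≡-Reasoning
    I′ : ℕ → ℤ
    I′ = interpolate e (Δ g)
    degΔ : Degree≤On L e (Δ g)
    degΔ j j+e<L = deg j (ℕ.≤-trans (ℕ.≤-reflexive (ℕ.+-suc j (suc e))) (s≤s j+e<L))
    step : ∀ a b → a + (b - a) ≡ b
    step = solve-∀

module PolyPart where

  open import Data.Nat.Base as ℕ using (zero; suc)
  open import Data.Integer.Base as ℤ using (ℤ; +_; 0ℤ; 1ℤ; _+_; _*_)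
  import Data.Integer.Properties as ℤ
  open import Data.Integer.Tactic.RingSolver using (solve-∀)
  open import Data.Fin.Base using (zero; suc)
  open import Data.Sum.Base using ([_,_]′)
  open import Function.Base using (_∘_; id)
  open import Relation.Binary.PropositionalEquality
  open import Defs using (polyPart)
  open PolynomialSequence

  polyPart-degree≤ : ∀ m a → Degree≤ m (λ j → polyPart m a (+ j))
  polyPart-degree≤ zero    a = Degree≤-const 0 0ℤ
  polyPart-degree≤ (suc m) a =
    Degree≤-+ (suc m) (λ j → a zero * ((+ j) ℤ.^ 1)) (λ j → polyPart m (a ∘ suc) (+ j) * + j)
      (Degree≤-cong (suc m) (λ j → cong (a zero *_) (sym (ℤ.*-identityʳ (+ j))))
         (Degree≤-*id m (λ _ → a zero) (Degree≤-const m (a zero))))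
      (Degree≤-*id m (λ j → polyPart m (a ∘ suc) (+ j)) (polyPart-degree≤ m (a ∘ suc)))

  polyPart-0 : ∀ m a → polyPart m a 0ℤ ≡ 0ℤ
  polyPart-0 zero    a = refl
  polyPart-0 (suc m) a = cong₂ _+_ (ℤ.*-zeroʳ (a zero)) (ℤ.*-zeroʳ (polyPart m (a ∘ suc) 0ℤ))

  polyPart≡0⇒coefficients≡0 : ∀ m a → (∀ j → polyPart m a (+ j) ≡ 0ℤ) → ∀ i → a i ≡ 0ℤ
  polyPart≡0⇒coefficients≡0 (suc m) a p≡0 = coefficient≡0
    where
    q r : ℕ → ℤ
    q j = polyPart m (a ∘ suc) (+ j)
    r j = a zero + q j
    factor : ∀ a₀ q x → a₀ * (x * 1ℤ) + q * x ≡ x * (a₀ + q)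
    factor = solve-∀
    r∘suc≡0 : ∀ j → r (suc j) ≡ 0ℤ
    r∘suc≡0 j = [ (λ ()) , id ]′ (ℤ.i*j≡0⇒i≡0∨j≡0 (+ suc j)
                  (trans (sym (factor (a zero) (q (suc j)) (+ suc j))) (p≡0 (suc j))))
    r₀≡0 : r 0 ≡ 0ℤ
    r₀≡0 = Degree≤-roots-suc⇒root-0 m r
             (Degree≤-+ m (λ _ → a zero) q (Degree≤-const m (a zero)) (polyPart-degree≤ m (a ∘ suc))) r∘suc≡0
    a₀≡0 : a zero ≡ 0ℤ
    a₀≡0 = trans (sym (ℤ.+-identityʳ (a zero))) (trans (cong (_+_ (a zero)) (sym (polyPart-0 m (a ∘ suc)))) r₀≡0)
    q≡0 : ∀ j → q j ≡ 0ℤ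
    q≡0 zero    = polyPart-0 m (a ∘ suc)
    q≡0 (suc j) = trans (sym (ℤ.+-identityˡ (q (suc j)))) (trans (cong (_+ q (suc j)) (sym a₀≡0)) (r∘suc≡0 j))
    coefficient≡0 : ∀ i → a i ≡ 0ℤ
    coefficient≡0 zero    = a₀≡0
    coefficient≡0 (suc i) = polyPart≡0⇒coefficients≡0 m (a ∘ suc) q≡0 i

module Counting where

  open import Data.Nat.Base as ℕ using (zero; suc; z≤n; s≤s; _+_; _*_; _≤_; _<_; _≡ᵇ_; _≤ᵇ_; _%_; _/_)
  import Data.Nat.Properties as ℕ
  open import Data.Nat.DivMod using (m<n⇒m%n≡m; m<n⇒m/n≡0; [m+n]%n≡m%n; m/n≡1+[m∸n]/n)
  open import Data.Bool.Base using (Bool; true; false; T; _∧_)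
  open import Data.Bool.Properties using (∧-identityʳ; ∧-zeroʳ)
  import Data.Integer.Base as ℤ
  open import Data.Fin.Base using (toℕ)
  open import Data.Fin.Subset using (∣_∣)
  open import Data.Vec.Base using (tabulate)
  open import Data.Vec.Properties using (lookup∘tabulate; []=⇒lookup)
  open import Data.Product.Base using (_×_; _,_)
  open import Function.Base using (_∘_)
  open import Relation.Binary.PropositionalEquality
  open import Defs using (_∈ℤ_)
  open Sum.ℕ∑ using (sum; sum-syntax; ∑-distrib-+; sum-replicate-zero)

  χ : Bool → ℕ
  χ true  = 1
  χ false = 0

  count : (ℕ → Bool) → ℕ → ℕ
  count f zero    = 0
  count f (suc M) = χ (f 0) + count (f ∘ suc) M

  ∣tabulate∣≡count : ∀ N f → ∣ tabulate {n = N} (f ∘ toℕ) ∣ ≡ count f N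
  ∣tabulate∣≡count zero    f = refl
  ∣tabulate∣≡count (suc N) f with f 0 | ∣tabulate∣≡count N (f ∘ suc)
  ... | true  | ∣p∣≡count = cong suc ∣p∣≡count
  ... | false | ∣p∣≡count = ∣p∣≡count

  ∈ℤ-tabulate : ∀ {N} f {v} → v ∈ℤ tabulate {n = N} (f ∘ toℕ) → v ≡ ℤ.+ ℤ.∣ v ∣ × T (f ℤ.∣ v ∣)
  ∈ℤ-tabulate f {v} (ι , +ι≡v , ι∈p) = trans (sym +ι≡v) (cong ℤ.+_ (sym ∣v∣≡ι)) , subst (T ∘ f) (sym ∣v∣≡ι) T[fι]
    where
    ∣v∣≡ι : ℤ.∣ v ∣ ≡ toℕ ι
    ∣v∣≡ι = cong ℤ.∣_∣ (sym +ι≡v)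
    T[fι] : T (f (toℕ ι))
    T[fι] = subst T (sym (trans (sym (lookup∘tabulate (f ∘ toℕ) ι)) ([]=⇒lookup ι∈p))) _

  count-mono-≤ : ∀ f {M N} → M ≤ N → count f M ≤ count f N
  count-mono-≤ f {zero}  z≤n       = z≤n
  count-mono-≤ f {suc M} (s≤s M≤N) = ℕ.+-monoʳ-≤ (χ (f 0)) (count-mono-≤ (f ∘ suc) M≤N)

  count-cong : ∀ M {f g} → (∀ y → y < M → f y ≡ g y) → count f M ≡ count g M
  count-cong zero    f≡g = refl
  count-cong (suc M) f≡g = cong₂ _+_ (cong χ (f≡g 0 (s≤s z≤n))) (count-cong M (λ y y<M → f≡g (suc y) (s≤s y<M)))

  count-false : ∀ M → count (λ _ → false) M ≡ 0
  count-false zero    = refl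
  count-false (suc M) = count-false M

  count-+ : ∀ a b f → count f (a + b) ≡ count f a + count (λ y → f (a + y)) b
  count-+ zero    b f = refl
  count-+ (suc a) b f = trans (cong (χ (f 0) +_) (count-+ a b (f ∘ suc))) (sym (ℕ.+-assoc (χ (f 0)) _ _))

  count-∧ʳ : ∀ M g b → count (λ y → g y ∧ b) M ≡ χ b * count g M
  count-∧ʳ M g true  = trans (count-cong M (λ y _ → ∧-identityʳ (g y))) (sym (ℕ.*-identityˡ (count g M)))
  count-∧ʳ M g false = trans (count-cong M (λ y _ → ∧-zeroʳ (g y))) (count-false M)

  count-≤ᵇ : ∀ B D → B < D → count (_≤ᵇ B) D ≡ suc B
  count-≤ᵇ zero    (suc D) _         = cong suc (count-false D)
  count-≤ᵇ (suc B) (suc D) (s≤s B<D) = cong suc (trans (count-cong D (λ y _ → suc≤ᵇsuc y)) (count-≤ᵇ B D B<D))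
    where
    suc≤ᵇsuc : ∀ y → (suc y ≤ᵇ suc B) ≡ (y ≤ᵇ B)
    suc≤ᵇsuc zero    = refl
    suc≤ᵇsuc (suc y) = refl

  count-divMod : ∀ D .{{_ : NonZero D}} M g h →
                 count (λ y → g (y % D) ∧ h (y / D)) (M * D) ≡ count h M * count g D
  count-divMod D zero    g h = refl
  count-divMod D (suc M) g h = begin
    count F (D + M * D)                                    ≡⟨ count-+ D (M * D) F ⟩
    count F D + count (λ y → F (D + y)) (M * D)            ≡⟨ cong₂ _+_ (count-cong D first-block)
                                                                (trans (count-cong (M * D) (λ y _ → later-blocks y))
                                                                       (count-divMod D M g (h ∘ suc))) ⟩
    count (λ y → g y ∧ h 0) D + count (h ∘ suc) M * count g D
                                                           ≡⟨ cong (_+ count (h ∘ suc) M * count g D) (count-∧ʳ D g (h 0)) ⟩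
    χ (h 0) * count g D + count (h ∘ suc) M * count g D    ≡⟨ ℕ.*-distribʳ-+ (count g D) (χ (h 0)) _ ⟨
    count h (suc M) * count g D                            ∎
    where
    open ≡-Reasoning
    F : ℕ → Bool
    F y = g (y % D) ∧ h (y / D)
    first-block : ∀ y → y < D → F y ≡ (g y ∧ h 0)
    first-block y y<D = cong₂ (λ r q → g r ∧ h q) (m<n⇒m%n≡m y<D) (m<n⇒m/n≡0 y<D)
    later-blocks : ∀ y → F (D + y) ≡ (g (y % D) ∧ h (suc (y / D)))
    later-blocks y = cong₂ (λ r q → g r ∧ h q)
      (trans (cong (_% D) (ℕ.+-comm D y)) ([m+n]%n≡m%n y D))
      (trans (m/n≡1+[m∸n]/n (ℕ.m≤m+n D y)) (cong (λ z → suc (z / D)) (ℕ.m+n∸m≡n D y)))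

  ∑χ[ℓ≡R]≡1 : ∀ K ℓ → ℓ < K → ∑[ R < K ] χ (ℓ ≡ᵇ toℕ R) ≡ 1
  ∑χ[ℓ≡R]≡1 (suc K) zero    _         = cong suc (sum-replicate-zero K)
  ∑χ[ℓ≡R]≡1 (suc K) (suc ℓ) (s≤s ℓ<K) = ∑χ[ℓ≡R]≡1 K ℓ ℓ<K

  count-partition : ∀ K (ℓ : ℕ → ℕ) f M → (∀ y → T (f y) → ℓ y < K) →
                    count f M ≡ ∑[ R < K ] count (λ y → f y ∧ (ℓ y ≡ᵇ toℕ R)) M
  count-partition K ℓ f zero    ℓ<K = sym (sum-replicate-zero K)
  count-partition K ℓ f (suc M) ℓ<K = begin
    χ (f 0) + count (f ∘ suc) M
      ≡⟨ cong₂ _+_ (sym (∑χ≡χ (f 0) (ℓ<K 0))) (count-partition K (ℓ ∘ suc) (f ∘ suc) M (ℓ<K ∘ suc)) ⟩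
    ∑[ R < K ] χ (f 0 ∧ (ℓ 0 ≡ᵇ toℕ R)) + ∑[ R < K ] count (λ y → f (suc y) ∧ (ℓ (suc y) ≡ᵇ toℕ R)) M
      ≡⟨ ∑-distrib-+ {K} (λ R → χ (f 0 ∧ (ℓ 0 ≡ᵇ toℕ R))) (λ R → count (λ y → f (suc y) ∧ (ℓ (suc y) ≡ᵇ toℕ R)) M) ⟨
    ∑[ R < K ] count (λ y → f y ∧ (ℓ y ≡ᵇ toℕ R)) (suc M)
      ∎
    where
    open ≡-Reasoning
    ∑χ≡χ : ∀ b → (T b → ℓ 0 < K) → ∑[ R < K ] χ (b ∧ (ℓ 0 ≡ᵇ toℕ R)) ≡ χ b
    ∑χ≡χ true  ℓ₀<K = ∑χ[ℓ≡R]≡1 K (ℓ 0) (ℓ₀<K _)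
    ∑χ≡χ false _    = sum-replicate-zero K

module Digits (B D : ℕ) .{{_ : NonZero D}} where

  open import Data.Nat.Base as ℕ using (zero; suc; z≤n; _≤_; _<_; _≡ᵇ_; _≤ᵇ_; _%_; _/_; _^_)
  import Data.Nat.Properties as ℕ
  open import Data.Nat.DivMod using (m≡m%n+[m/n]*n; m<n⇒m%n≡m; 0/n≡0)
  open import Data.Integer.Base as ℤ using (+_; 0ℤ; _+_; _*_; ∣_∣)
  import Data.Integer.Properties as ℤ
  open import Data.Integer.Tactic.RingSolver using (solve-∀)
  open import Data.Bool.Base using (Bool; T; _∧_)
  open import Data.Bool.Properties using (T-∧)
  open import Data.Fin.Base using (Fin; zero; suc; toℕ)
  open import Data.Product.Base using (_×_; _,_; proj₁; proj₂)
  open import Function.Base using (_∘_)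
  open import Function.Bundles using (Equivalence)
  open import Relation.Binary.PropositionalEquality
  open Difference
  open PolynomialSequence using (Degree≤On)
  open Sum.ℕ∑ using (sum-syntax)
  open Counting using (count; count-divMod; count-≤ᵇ)

  digit : ℕ → ℕ → ℕ
  digit zero    y = y % D
  digit (suc k) y = digit k (y / D)

  smallDigits : ℕ → ℕ → Bool
  smallDigits zero    y = y ≡ᵇ 0
  smallDigits (suc n) y = (y % D ≤ᵇ B) ∧ smallDigits n (y / D)

  normSq : ℕ → ℕ → ℕ
  normSq n y = ∑[ k < n ] (digit (toℕ k) y ℕ.* digit (toℕ k) y)

  smallDigits-zero : ∀ {y} → T (smallDigits 0 y) → y ≡ 0
  smallDigits-zero {y} = ℕ.≡ᵇ⇒≡ y 0

  smallDigits-head : ∀ n {y} → T (smallDigits (suc n) y) → y % D ≤ B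
  smallDigits-head n {y} = ℕ.≤ᵇ⇒≤ (y % D) B ∘ proj₁ ∘ Equivalence.to T-∧

  smallDigits-tail : ∀ n {y} → T (smallDigits (suc n) y) → T (smallDigits n (y / D))
  smallDigits-tail n = proj₂ ∘ Equivalence.to T-∧

  digit-0 : ∀ k → digit k 0 ≡ 0
  digit-0 zero    = m<n⇒m%n≡m (ℕ.>-nonZero⁻¹ D)
  digit-0 (suc k) = trans (cong (digit k) (0/n≡0 D)) (digit-0 k)

  digits-injective : ∀ n {y y′} → T (smallDigits n y) → T (smallDigits n y′) →
                     (∀ (k : Fin n) → digit (toℕ k) y ≡ digit (toℕ k) y′) → y ≡ y′
  digits-injective zero    small small′ same = trans (smallDigits-zero small) (sym (smallDigits-zero small′))
  digits-injective (suc n) {y} {y′} small small′ same = begin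
    y                         ≡⟨ m≡m%n+[m/n]*n y D ⟩
    y % D ℕ.+ y / D ℕ.* D     ≡⟨ cong₂ (λ r q → r ℕ.+ q ℕ.* D) (same zero)
                                   (digits-injective n (smallDigits-tail n small) (smallDigits-tail n small′) (same ∘ suc)) ⟩
    y′ % D ℕ.+ y′ / D ℕ.* D   ≡⟨ m≡m%n+[m/n]*n y′ D ⟨
    y′                        ∎
    where open ≡-Reasoning

  normSq≤ : ∀ n y → T (smallDigits n y) → normSq n y ≤ n ℕ.* (B ℕ.* B)
  normSq≤ zero    y small = z≤n
  normSq≤ (suc n) y small =
    ℕ.+-mono-≤ (ℕ.*-mono-≤ (smallDigits-head n small) (smallDigits-head n small))
               (normSq≤ n (y / D) (smallDigits-tail n small))

  count-smallDigits : B < D → ∀ n → count (smallDigits n) (D ^ n) ≡ suc B ^ n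
  count-smallDigits B<D zero    = refl
  count-smallDigits B<D (suc n) = begin
    count (smallDigits (suc n)) (D ℕ.* D ^ n)               ≡⟨ cong (count (smallDigits (suc n))) (ℕ.*-comm D (D ^ n)) ⟩
    count (smallDigits (suc n)) (D ^ n ℕ.* D)               ≡⟨ count-divMod D (D ^ n) (_≤ᵇ B) (smallDigits n) ⟩
    count (smallDigits n) (D ^ n) ℕ.* count (_≤ᵇ B) D       ≡⟨ cong₂ ℕ._*_ (count-smallDigits B<D n) (count-≤ᵇ B D B<D) ⟩
    suc B ^ n ℕ.* suc B                                     ≡⟨ ℕ.*-comm (suc B ^ n) (suc B) ⟩
    suc B ^ suc n                                           ∎
    where open ≡-Reasoning

  +-divMod : ∀ y → + y ≡ + (y % D) + + D * + (y / D)
  +-divMod y = begin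
    + y                               ≡⟨ cong +_ (trans (m≡m%n+[m/n]*n y D) (cong (y % D ℕ.+_) (ℕ.*-comm (y / D) D))) ⟩
    + (y % D ℕ.+ D ℕ.* (y / D))       ≡⟨ ℤ.pos-+ (y % D) _ ⟩
    + (y % D) + + (D ℕ.* (y / D))     ≡⟨ cong (_+_ (+ (y % D))) (ℤ.pos-* D (y / D)) ⟩
    + (y % D) + + D * + (y / D)       ∎
    where open ≡-Reasoning

  i+D*j≡0⇒i≡0×j≡0 : ∀ i j → i + + D * j ≡ 0ℤ → ∣ i ∣ < D → i ≡ 0ℤ × j ≡ 0ℤ
  i+D*j≡0⇒i≡0×j≡0 i j i+Dj≡0 ∣i∣<D = i≡0 , j≡0
    where
    negate : ∀ i x → i ≡ ℤ.- x + (i + x)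
    negate = solve-∀
    i≡-Dj : i ≡ ℤ.- (+ D * j)
    i≡-Dj = trans (negate i (+ D * j)) (trans (cong (_+_ (ℤ.- (+ D * j))) i+Dj≡0) (ℤ.+-identityʳ _))
    D∣j∣<D*1 : D ℕ.* ∣ j ∣ < D ℕ.* 1
    D∣j∣<D*1 = subst₂ _<_ (trans (cong ∣_∣ i≡-Dj) (trans (ℤ.∣-i∣≡∣i∣ (+ D * j)) (ℤ.abs-* (+ D) j)))
                          (sym (ℕ.*-identityʳ D)) ∣i∣<D
    j≡0 : j ≡ 0ℤ
    j≡0 = ℤ.∣i∣≡0⇒i≡0 (ℕ.n<1⇒n≡0 (ℕ.*-cancelˡ-< D _ _ D∣j∣<D*1))
    i≡0 : i ≡ 0ℤ
    i≡0 = trans i≡-Dj (cong (ℤ.-_) (trans (cong (+ D *_) j≡0) (ℤ.*-zeroʳ (+ D))))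

  -- With y = y % D + D (y / D), the difference Δ^(e+1) of the low digits is bounded by B 2^(e+1) < D,
  -- so it cannot cancel a nonzero multiple of D: there are no carries.
  digit-Degree≤On : ∀ e → B ℕ.* 2 ^ suc e < D → ∀ n L (Y : ℕ → ℕ) → (∀ j → j ≤ L → T (smallDigits n (Y j))) →
                    Degree≤On L e (λ j → + Y j) → ∀ k → Degree≤On L e (λ j → + digit k (Y j))
  digit-Degree≤On e B2^e<D zero    L Y small Y-deg k j j+e<L =
    trans (Δ^-local (suc e) (λ i → + digit k (Y i)) (λ _ → 0ℤ) j
             (λ i i≤e → cong +_ (trans (cong (digit k) (smallDigits-zero (small (i ℕ.+ j) (window-≤ i≤e j+e<L))))
                                        (digit-0 k))))
          (Δ^-0 (suc e) j)
  digit-Degree≤On e B2^e<D (suc n) L Y small Y-deg = digit-deg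
    where
    low high : ℕ → ℕ
    low j  = Y j % D
    high j = Y j / D
    Δ^-divMod : ∀ j → Δ^ (suc e) (λ i → + Y i) j ≡ Δ^ (suc e) (λ i → + low i) j + + D * Δ^ (suc e) (λ i → + high i) j
    Δ^-divMod j = trans (Δ^-cong (suc e) (λ i → +-divMod (Y i)) j)
                    (trans (Δ^-+ (suc e) (λ i → + low i) (λ i → + D * + high i) j)
                           (cong (_+_ (Δ^ (suc e) (λ i → + low i) j)) (Δ^-*ˡ (suc e) (+ D) (λ i → + high i) j)))
    ∣Δ^low∣<D : ∀ j → j ℕ.+ suc e ≤ L → ∣ Δ^ (suc e) (λ i → + low i) j ∣ < D
    ∣Δ^low∣<D j j+e<L = ℕ.≤-<-trans
      (∣Δ^∣≤ (suc e) (λ i → + low i) j B (λ i i≤e → smallDigits-head n (small (i ℕ.+ j) (window-≤ i≤e j+e<L)))) B2^e<D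
    Δ^low≡0×Δ^high≡0 : ∀ j → j ℕ.+ suc e ≤ L →
      Δ^ (suc e) (λ i → + low i) j ≡ 0ℤ × Δ^ (suc e) (λ i → + high i) j ≡ 0ℤ
    Δ^low≡0×Δ^high≡0 j j+e<L =
      i+D*j≡0⇒i≡0×j≡0 _ _ (trans (sym (Δ^-divMod j)) (Y-deg j j+e<L)) (∣Δ^low∣<D j j+e<L)
    digit-deg : ∀ k → Degree≤On L e (λ j → + digit k (Y j))
    digit-deg zero    j j+e<L = proj₁ (Δ^low≡0×Δ^high≡0 j j+e<L)
    digit-deg (suc k) = digit-Degree≤On e B2^e<D n L high (λ j j≤L → smallDigits-tail n (small j j≤L))
                          (λ j j+e<L → proj₂ (Δ^low≡0×Δ^high≡0 j j+e<L)) k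

module DigitSphere (m B D : ℕ) .{{_ : NonZero D}} (B2^m+1<D : B ℕ.* 2 ℕ.^ ℕ.suc m ℕ.< D) where

  open import Data.Nat.Base as ℕ using (suc; z≤n; s≤s; _+_; _*_; _^_; _≤_; _<_; _≡ᵇ_)
  import Data.Nat.Properties as ℕ
  open import Data.Nat.Tactic.RingSolver as ℕ using ()
  open import Data.Integer.Base as ℤ using (ℤ; +_; 0ℤ; _-_)
  import Data.Integer.Properties as ℤ
  open import Data.Integer.Tactic.RingSolver using (solve-∀)
  open import Data.Bool.Base using (Bool; T; _∧_)
  open import Data.Bool.Properties using (T-∧)
  open import Data.Fin.Base using (Fin; toℕ; fromℕ<)
  open import Data.Fin.Properties using (toℕ-fromℕ<)
  open import Data.Fin.Subset using (Subset; ∣_∣)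
  open import Data.Vec.Base using (tabulate)
  open import Data.Product.Base using (∃; _×_; _,_; proj₁; proj₂)
  open import Function.Base using (_∘_)
  open import Function.Bundles using (Equivalence)
  open import Relation.Binary.PropositionalEquality
  open import Defs using (polyPart; ConfigFree)
  open Sum using (∑-+; pigeonhole; module ℕ∑; module ℤ∑)
  open PolynomialSequence
  open PolyPart
  open Counting
  open Digits B D
  open ℤ∑ using (sum-syntax)

  inSphere : ℕ → ℕ → ℕ → Bool
  inSphere n R y = smallDigits n y ∧ (normSq n y ≡ᵇ R)

  sphere : (n R N : ℕ) → Subset N
  sphere n R N = tabulate (inSphere n R ∘ toℕ)

  +normSq≡∑ : ∀ n y → + normSq n y ≡ ∑[ k < n ] (+ digit (toℕ k) y ℤ.* + digit (toℕ k) y)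
  +normSq≡∑ n y = trans (sym (∑-+ n _)) (ℤ∑.sum-cong-≗ {n} (λ k → ℤ.pos-* (digit (toℕ k) y) _))

  progression-in-sphere⇒constant : ∀ n R (Y : ℕ → ℕ) → Degree≤On (m + m) m (λ j → + Y j) →
    (∀ j → j ≤ m + m → T (inSphere n R (Y j))) → ∀ j → j ≤ m + m → Y j ≡ Y 0
  progression-in-sphere⇒constant n R Y Y-deg inSphere-Y j j≤2m =
    digits-injective n (small j j≤2m) (small 0 z≤n) same-digits
    where
    small : ∀ j → j ≤ m + m → T (smallDigits n (Y j))
    small j j≤2m = proj₁ (Equivalence.to T-∧ (inSphere-Y j j≤2m))
    normSq≡R : ∀ j → j ≤ m + m → normSq n (Y j) ≡ R
    normSq≡R j j≤2m = ℕ.≡ᵇ⇒≡ _ R (proj₂ (Equivalence.to T-∧ (inSphere-Y j j≤2m)))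
    -- The digit sequences are polynomial only on [0, 2m]; the product rule needs global ones.
    w : Fin n → ℕ → ℤ
    w k = interpolate m (λ j → + digit (toℕ k) (Y j))
    w≡digit : ∀ k j → j ≤ m + m → w k j ≡ + digit (toℕ k) (Y j)
    w≡digit k = interpolate-agrees m _ (m + m) (digit-Degree≤On m B2^m+1<D n (m + m) Y small Y-deg (toℕ k))
    ∑w²≡R : ∀ j → j ≤ m + m → ∑[ k < n ] (w k j ℤ.* w k j) ≡ + R
    ∑w²≡R j j≤2m = trans (ℤ∑.sum-cong-≗ {n} (λ k → cong₂ ℤ._*_ (w≡digit k j j≤2m) (w≡digit k j j≤2m)))
                         (trans (sym (+normSq≡∑ n (Y j))) (cong +_ (normSq≡R j j≤2m)))
    w-const : ∀ k → Degree≤ 0 (w k)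
    w-const = constantSumOfSquares⇒constant m n w (+ R) (λ k → interpolate-degree≤ m _) ∑w²≡R
    same-digits : ∀ k → digit (toℕ k) (Y j) ≡ digit (toℕ k) (Y 0)
    same-digits k = ℤ.+-injective (begin
      + digit (toℕ k) (Y j)   ≡⟨ w≡digit k j j≤2m ⟨
      w k j                   ≡⟨ Degree≤0⇒const (w k) (w-const k) j ⟩
      w k 0                   ≡⟨ w≡digit k 0 z≤n ⟩
      + digit (toℕ k) (Y 0)   ∎)
      where open ≡-Reasoning

  sphere-configFree : ∀ n R N → ConfigFree m (2 * m + 1) (sphere n R N)
  sphere-configFree n R N (x , a , (i , aᵢ≢0) , onSphere) = aᵢ≢0 (polyPart≡0⇒coefficients≡0 m a p≡0 i)
    where
    p F : ℕ → ℤ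
    p j = polyPart m a (+ j)
    F j = x ℤ.+ p j
    j<2m+1 : ∀ {j} → j ≤ m + m → j < 2 * m + 1
    j<2m+1 {j} j≤2m = ℕ.≤-trans (s≤s j≤2m) (ℕ.≤-reflexive (twice m))
      where
      twice : ∀ m → suc (m + m) ≡ 2 * m + 1
      twice = ℕ.solve-∀
    F∈sphere : ∀ j → j ≤ m + m → F j ≡ + ℤ.∣ F j ∣ × T (inSphere n R ℤ.∣ F j ∣)
    F∈sphere j j≤2m = subst (λ t → F t ≡ + ℤ.∣ F t ∣ × T (inSphere n R ℤ.∣ F t ∣)) (toℕ-fromℕ< (j<2m+1 j≤2m))
                        (∈ℤ-tabulate (inSphere n R) (onSphere (fromℕ< (j<2m+1 j≤2m))))
    F-deg : Degree≤ m F
    F-deg = Degree≤-+ m (λ _ → x) p (Degree≤-const m x) (polyPart-degree≤ m a)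
    ∣F∣-deg : Degree≤On (m + m) m (λ j → + ℤ.∣ F j ∣)
    ∣F∣-deg = Degree≤-agree⇒Degree≤On (m + m) m F _ F-deg (λ j j≤2m → proj₁ (F∈sphere j j≤2m))
    F-const : ∀ j → j ≤ m + m → F j ≡ F 0
    F-const j j≤2m = begin
      F j              ≡⟨ proj₁ (F∈sphere j j≤2m) ⟩
      + ℤ.∣ F j ∣      ≡⟨ cong +_ (progression-in-sphere⇒constant n R (λ j → ℤ.∣ F j ∣) ∣F∣-deg
                                     (λ j j≤2m → proj₂ (F∈sphere j j≤2m)) j j≤2m) ⟩
      + ℤ.∣ F 0 ∣      ≡⟨ proj₁ (F∈sphere 0 z≤n) ⟨
      F 0              ∎
      where open ≡-Reasoning
    p≡0 : ∀ j → p j ≡ 0ℤ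
    p≡0 = Degree≤-roots⇒≡0 m p (polyPart-degree≤ m a) (λ j j≤m → begin
      p j              ≡⟨ cancel x (p j) ⟩
      F j - x          ≡⟨ cong (_- x) (F-const j (ℕ.≤-trans j≤m (ℕ.m≤m+n m m))) ⟩
      F 0 - x          ≡⟨ cancel x (p 0) ⟨
      p 0              ≡⟨ polyPart-0 m a ⟩
      0ℤ               ∎)
      where
      open ≡-Reasoning
      cancel : ∀ x y → y ≡ x ℤ.+ y - x
      cancel = solve-∀

  sphere-large : ∀ n N → D ^ n ≤ N → ∃ λ R → suc B ^ n ≤ suc (n * (B * B)) * ∣ sphere n R N ∣
  sphere-large n N D^n≤N with pigeonhole (n * (B * B)) (λ R → count (inSphere n (toℕ R)) (D ^ n))
  ... | R , ∑≤K*count = toℕ R , (begin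
    suc B ^ n                                                ≡⟨ count-smallDigits B<D n ⟨
    count (smallDigits n) (D ^ n)                            ≡⟨ count-partition K (normSq n) (smallDigits n) (D ^ n) normSq<K ⟩
    ℕ∑.sum {K} (λ R′ → count (inSphere n (toℕ R′)) (D ^ n)) ≤⟨ ∑≤K*count ⟩
    K * count (inSphere n (toℕ R)) (D ^ n)                   ≤⟨ ℕ.*-monoʳ-≤ K (count-mono-≤ (inSphere n (toℕ R)) D^n≤N) ⟩
    K * count (inSphere n (toℕ R)) N                         ≡⟨ cong (K *_) (∣tabulate∣≡count N (inSphere n (toℕ R))) ⟨
    K * ∣ sphere n (toℕ R) N ∣                               ∎)
    where
    open ℕ.≤-Reasoning
    K : ℕ
    K = suc (n * (B * B))
    B<D : B < D
    B<D = ℕ.≤-<-trans (ℕ.m≤m*n B (2 ^ suc m) {{ℕ.m^n≢0 2 (suc m)}}) B2^m+1<D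
    normSq<K : ∀ y → T (smallDigits n y) → normSq n y < K
    normSq<K y small = s≤s (normSq≤ n y small)

open import Data.Nat.Base using (zero; suc; z≤n; s≤s; _+_; _*_; _^_; _∸_; _≤_; _<_; pred)
import Data.Nat.Properties as ℕ
open import Data.Nat.Tactic.RingSolver using (solve-∀)
open import Data.Fin.Subset using (Subset; ∣_∣)
open import Data.Product.Base using (Σ; ∃; _×_; _,_)
open import Relation.Binary.PropositionalEquality
open import Relation.Nullary using (¬_; yes; no)
open import Relation.Nullary.Negation using (contradiction)
open import Relation.Unary using (Decidable)
open import Defs using (ConfigFree)

threshold : ∀ (P : ℕ → Set) → Decidable P → P 0 → ∀ L → ¬ P L → ∃ λ t → t < L × P t × ¬ P (suc t)
threshold P P? P0 zero    ¬PL = contradiction P0 ¬PL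
threshold P P? P0 (suc L) ¬PL with P? L
... | yes PL = L , ℕ.≤-refl , PL , ¬PL
... | no ¬PL′ with threshold P P? P0 L ¬PL′
...   | t , t<L , Pt , ¬Pt+1 = t , ℕ.m<n⇒m<1+n t<L , Pt , ¬Pt+1

exponent-bracket : ∀ N s → 2 ≤ N → N ≤ 2 ^ (s * s) → ∃ λ t → t ≤ s × 2 ^ (t * s) ≤ N × N < 2 ^ (suc t * s)
exponent-bracket N zero    2≤N N≤1 = contradiction (ℕ.≤-trans 2≤N N≤1) λ { (s≤s ()) }
exponent-bracket N (suc s) 2≤N N≤2^s² =
  let t , t<s+2 , 2^ts≤N , ¬2^[t+1]s≤N = threshold (λ t → 2 ^ (t * suc s) ≤ N) (λ t → 2 ^ (t * suc s) ℕ.≤? N)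
                                           (ℕ.≤-trans (s≤s z≤n) 2≤N) (suc (suc s)) ¬2^[s+2][s+1]≤N
  in  t , ℕ.≤-pred t<s+2 , 2^ts≤N , ℕ.≰⇒> ¬2^[t+1]s≤N
  where
  ¬2^[s+2][s+1]≤N : ¬ 2 ^ (suc (suc s) * suc s) ≤ N
  ¬2^[s+2][s+1]≤N le = ℕ.<-irrefl refl (ℕ.≤-<-trans (ℕ.≤-trans le N≤2^s²)
    (ℕ.^-monoʳ-< 2 (s≤s (s≤s z≤n)) (ℕ.m<n+m (suc s * suc s) {suc s} (s≤s z≤n))))

n<2^n : ∀ n → n < 2 ^ n
n<2^n zero    = s≤s z≤n
n<2^n (suc n) = ℕ.≤-trans (ℕ.+-mono-≤ (ℕ.m^n>0 2 n) (n<2^n n))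
                          (ℕ.≤-reflexive (cong (2 ^ n +_) (sym (ℕ.+-identityʳ (2 ^ n)))))

-- The subtraction t ∸ suc m truncates: for t ≤ m + 1 only the digit 0 is allowed.
largestDigit : ℕ → ℕ → ℕ
largestDigit m t = pred (2 ^ (t ∸ suc m))

1+largestDigit : ∀ m t → suc (largestDigit m t) ≡ 2 ^ (t ∸ suc m)
1+largestDigit m t = ℕ.suc-pred (2 ^ (t ∸ suc m)) {{ℕ.m^n≢0 2 (t ∸ suc m)}}

largestDigit*2^[m+1]<2^t : ∀ m t → largestDigit m t * 2 ^ suc m < 2 ^ t
largestDigit*2^[m+1]<2^t m t with suc m ℕ.≤? t
... | yes m<t = begin-strict
  largestDigit m t * 2 ^ suc m   <⟨ ℕ.*-monoˡ-< (2 ^ suc m) {{ℕ.m^n≢0 2 (suc m)}}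
                                      (ℕ.≤-reflexive (1+largestDigit m t)) ⟩
  2 ^ (t ∸ suc m) * 2 ^ suc m    ≡⟨ ℕ.^-distribˡ-+-* 2 (t ∸ suc m) (suc m) ⟨
  2 ^ (t ∸ suc m + suc m)        ≡⟨ cong (2 ^_) (ℕ.m∸n+n≡m m<t) ⟩
  2 ^ t                          ∎
  where open ℕ.≤-Reasoning
... | no  m≮t = subst (λ u → pred (2 ^ u) * 2 ^ suc m < 2 ^ t)
                    (sym (ℕ.m≤n⇒m∸n≡0 (ℕ.<⇒≤ (ℕ.≰⇒> m≮t)))) (ℕ.m^n>0 2 t)

largestDigit<2^s : ∀ m t s → t ≤ s → largestDigit m t < 2 ^ s
largestDigit<2^s m t s t≤s =
  ℕ.≤-trans (ℕ.≤-reflexive (1+largestDigit m t)) (ℕ.^-monoʳ-≤ 2 (ℕ.≤-trans (ℕ.m∸n≤m t (suc m)) t≤s))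

density-bound : ∀ m s t a N → t ≤ s → N < 2 ^ (suc t * s) →
                suc (largestDigit m t) ^ s ≤ suc (s * (largestDigit m t * largestDigit m t)) * a →
                N ≤ a * 2 ^ ((5 + m) * s)
density-bound m s t a N t≤s N<2^[t+1]s large = begin
  N                                ≤⟨ ℕ.<⇒≤ N<2^[t+1]s ⟩
  2 ^ (suc t * s)                  ≤⟨ ℕ.^-monoʳ-≤ 2 (ℕ.*-monoˡ-≤ s (s≤s (ℕ.m≤n+m∸n t (suc m)))) ⟩
  2 ^ ((2 + m + u) * s)            ≡⟨ cong (2 ^_) (ℕ.*-distribʳ-+ s (2 + m) u) ⟩
  2 ^ ((2 + m) * s + u * s)        ≡⟨ ℕ.^-distribˡ-+-* 2 ((2 + m) * s) (u * s) ⟩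
  Q * 2 ^ (u * s)                  ≡⟨ cong (Q *_) (trans (cong (_^ s) (1+largestDigit m t)) (ℕ.^-*-assoc 2 u s)) ⟨
  Q * suc B ^ s                    ≤⟨ ℕ.*-monoʳ-≤ Q (ℕ.≤-trans large (ℕ.*-monoˡ-≤ a 1+sB²≤P³)) ⟩
  Q * (P * (P * P) * a)            ≡⟨ rearrange P Q a ⟩
  a * (P * (P * (P * Q)))          ≡⟨ cong (a *_) 2^[5+m]s ⟨
  a * 2 ^ ((5 + m) * s)            ∎
  where
  open ℕ.≤-Reasoning
  u B P Q : ℕ
  u = t ∸ suc m
  B = largestDigit m t
  P = 2 ^ s
  Q = 2 ^ ((2 + m) * s)
  1+sB²≤P³ : suc (s * (B * B)) ≤ P * (P * P)
  1+sB²≤P³ = ℕ.*-mono-< (n<2^n s) (ℕ.*-mono-< (largestDigit<2^s m t s t≤s) (largestDigit<2^s m t s t≤s))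
  rearrange : ∀ P Q a → Q * (P * (P * P) * a) ≡ a * (P * (P * (P * Q)))
  rearrange = solve-∀
  2^[5+m]s : 2 ^ ((5 + m) * s) ≡ P * (P * (P * Q))
  2^[5+m]s = begin-equality
    2 ^ ((5 + m) * s)                  ≡⟨ cong (2 ^_) (split m s) ⟩
    2 ^ (s + (s + (s + (2 + m) * s)))  ≡⟨ ℕ.^-distribˡ-+-* 2 s _ ⟩
    P * 2 ^ (s + (s + (2 + m) * s))    ≡⟨ cong (P *_) (ℕ.^-distribˡ-+-* 2 s _) ⟩
    P * (P * 2 ^ (s + (2 + m) * s))    ≡⟨ cong (λ x → P * (P * x)) (ℕ.^-distribˡ-+-* 2 s _) ⟩
    P * (P * (P * Q))                  ∎
    where
    split : ∀ m s → (5 + m) * s ≡ s + (s + (s + (2 + m) * s))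
    split = solve-∀

sphere-density : ∀ m N s t → t ≤ s → 2 ^ (t * s) ≤ N → N < 2 ^ (suc t * s) →
                 Σ (Subset N) λ A → ConfigFree m (2 * m + 1) A × (N ≤ ∣ A ∣ * 2 ^ ((5 + m) * s))
sphere-density m N s t t≤s 2^ts≤N N<2^[t+1]s =
  let R , large = sphere-large s N (subst (_≤ N) (sym (ℕ.^-*-assoc 2 t s)) 2^ts≤N)
  in  sphere s R N , sphere-configFree s R N , density-bound m s t ∣ sphere s R N ∣ N t≤s N<2^[t+1]s large
  where open DigitSphere m (largestDigit m t) (2 ^ t) {{ℕ.m^n≢0 2 t}} (largestDigit*2^[m+1]<2^t m t)

-- The construction works for every m.
proposition2p1 :
    (m : ℕ) → 1 ≤ m →
    Σ ℕ λ C → (N : ℕ) → 2 ≤ N → (s : ℕ) → N ≤ 2 ^ (s * s) →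
      Σ (Subset N) λ A → ConfigFree m (2 * m + 1) A × (N ≤ ∣ A ∣ * 2 ^ (C * s))
proposition2p1 m _ = 5 + m , λ N 2≤N s N≤2^s² →
  let t , t≤s , 2^ts≤N , N<2^[t+1]s = exponent-bracket N s 2≤N N≤2^s²
  in  sphere-density m N s t t≤s 2^ts≤N N<2^[t+1]s
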